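{- Let $B$ be a Boruvka tree with $n$ nodes and height $h$. Then for every integer $k \ge 1$, the number of nodes of $B$ with depth at most $k$ is at most $\dfrac{n}{2^{h-k}}$.
   Context: Rooted trees: the depth of a node is the number of vertices on the path from the root to it (the root has depth 1); the height is the maximum depth. Boruvka tree of an edge-weighted tree $T$: run Boruvka's (maximum spanning tree) algorithm on $T$; start with one leaf per vertex of $T$; in each round every current (hyper)node marks its incident edge of maximum weight, the connected components of marked edges are contracted into hypernodes, and for each contracted component $C$ a new node $v_C$ is created which becomes the parent of the nodes representing the members of $C$ (with edge weight equal to the weight of the edge that member selected); repeat until a single hypernode remains, which is the root. Such a tree has the properties that all its leaves have the same depth and every internal node has at least two children. -}

module Defs where

open import Data.Nat using (ℕ; zero; suc; _+_; _⊔_; _≤_)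
open import Data.List using (List; []; _∷_; length)
open import Data.List.Relation.Unary.All using (All)
open import Data.Product using (∃; _×_)

data Tree : Set where
  node : List Tree → Tree

mutual
  size : Tree → ℕ
  size (node ts) = suc (sizes ts)

  sizes : List Tree → ℕ
  sizes []       = 0
  sizes (t ∷ ts) = size t + sizes ts

mutual
  height : Tree → ℕ
  height (node ts) = suc (heights ts)

  heights : List Tree → ℕ
  heights []       = 0
  heights (t ∷ ts) = height t ⊔ heights ts

mutual
  -- nodesUpTo k t = number of nodes of t with depth at most k (root has depth 1)
  nodesUpTo : ℕ → Tree → ℕ
  nodesUpTo zero    t         = 0
  nodesUpTo (suc k) (node ts) = suc (nodesUpTos k ts)

  nodesUpTos : ℕ → List Tree → ℕ
  nodesUpTos k []       = 0
  nodesUpTos k (t ∷ ts) = nodesUpTo k t + nodesUpTos k ts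

data LeavesAt : ℕ → Tree → Set where
  leaf  : LeavesAt 1 (node [])
  inner : ∀ {d t ts} → All (LeavesAt d) (t ∷ ts) → LeavesAt (suc d) (node (t ∷ ts))

data Branching : Tree → Set where
  leaf  : Branching (node [])
  inner : ∀ {t ts} → 2 ≤ length (t ∷ ts) → All Branching (t ∷ ts) → Branching (node (t ∷ ts))

-- The structural properties of Boruvka trees stated in the paper:
-- all leaves have the same depth and every internal node has >= 2 children.
IsBoruvkaTree : Tree → Set
IsBoruvkaTree t = (∃ λ d → LeavesAt d t) × Branching t

{-# OPTIONS --safe #-}
-- Let N k be the number of nodes of depth at most k.  Below the last level every
-- node has at least two children, so N (k + 1) ≥ 2 N k + 1.  Iterating from k up
-- to the height h gives N k · 2^(h − k) ≤ N h = n.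
module Submission where

open import Defs
open import Data.Nat using (ℕ; zero; suc; _+_; _*_; _∸_; _^_; _⊔_; _≤_; _<_; z≤n; s≤s)
open import Data.Nat.Properties
open import Data.Nat.Tactic.RingSolver using (solve-∀)
open import Data.List using ([]; _∷_; length)
open import Data.List.Relation.Unary.All using (All; []; _∷_)
open import Data.Product using (_,_)
open import Data.Sum using (inj₁; inj₂)
open import Relation.Binary.PropositionalEquality

mutual
  nodesUpTo-size : ∀ k t → height t ≤ k → nodesUpTo k t ≡ size t
  nodesUpTo-size (suc k) (node ts) (s≤s h≤k) = cong suc (nodesUpTos-sizes k ts h≤k)

  nodesUpTos-sizes : ∀ k ts → heights ts ≤ k → nodesUpTos k ts ≡ sizes ts
  nodesUpTos-sizes k []       _   = refl
  nodesUpTos-sizes k (t ∷ ts) h≤k =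
    cong₂ _+_ (nodesUpTo-size k t (m⊔n≤o⇒m≤o _ _ h≤k))
              (nodesUpTos-sizes k ts (m⊔n≤o⇒n≤o _ _ h≤k))

mutual
  LeavesAt⇒height≡ : ∀ {d t} → LeavesAt d t → height t ≡ d
  LeavesAt⇒height≡ leaf         = refl
  LeavesAt⇒height≡ (inner all) = cong suc (All-LeavesAt⇒heights≡ all)

  All-LeavesAt⇒heights≡ : ∀ {d t ts} → All (LeavesAt d) (t ∷ ts) → heights (t ∷ ts) ≡ d
  All-LeavesAt⇒heights≡ {d} (l ∷ []) =
    trans (cong (_⊔ 0) (LeavesAt⇒height≡ l)) (⊔-identityʳ d)
  All-LeavesAt⇒heights≡ {d} (l ∷ ls@(_ ∷ _)) =
    trans (cong₂ _⊔_ (LeavesAt⇒height≡ l) (All-LeavesAt⇒heights≡ ls)) (⊔-idem d)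

-- The "+ 1" is needed for the induction: the root adds 2 to the left-hand side
-- but only 1 to the right, and the missing 1 comes from its second child.
mutual
  nodesUpTo-doubling : ∀ {d t} → LeavesAt d t → Branching t → ∀ k → k < d →
                       2 * nodesUpTo k t + 1 ≤ nodesUpTo (suc k) t
  nodesUpTo-doubling {t = node _} _ _ zero _ = s≤s z≤n
  nodesUpTo-doubling leaf _ (suc k) (s≤s ())
  nodesUpTo-doubling (inner {ts = ts} ls) (inner {t = c} 2≤len bs) (suc k) (s≤s k<d) =
    begin
      2 * suc X + 1                 ≡⟨ rearrange X ⟩
      suc (2 * X + 2)               ≤⟨ s≤s (+-monoʳ-≤ (2 * X) 2≤len) ⟩
      suc (2 * X + length (c ∷ ts)) ≤⟨ s≤s (nodesUpTos-doubling k k<d (c ∷ ts) ls bs) ⟩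
      suc (nodesUpTos (suc k) (c ∷ ts)) ∎
    where
      open ≤-Reasoning
      X : ℕ
      X = nodesUpTos k (c ∷ ts)
      rearrange : ∀ X → 2 * suc X + 1 ≡ suc (2 * X + 2)
      rearrange = solve-∀

  nodesUpTos-doubling : ∀ {d} k → k < d → ∀ ts → All (LeavesAt d) ts → All Branching ts →
                        2 * nodesUpTos k ts + length ts ≤ nodesUpTos (suc k) ts
  nodesUpTos-doubling k k<d []       []       []       = z≤n
  nodesUpTos-doubling k k<d (t ∷ ts) (l ∷ ls) (b ∷ bs) =
    begin
      2 * (nodesUpTo k t + nodesUpTos k ts) + suc (length ts)
        ≡⟨ regroup (nodesUpTo k t) (nodesUpTos k ts) (length ts) ⟩
      (2 * nodesUpTo k t + 1) + (2 * nodesUpTos k ts + length ts)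
        ≤⟨ +-mono-≤ (nodesUpTo-doubling l b k k<d) (nodesUpTos-doubling k k<d ts ls bs) ⟩
      nodesUpTo (suc k) t + nodesUpTos (suc k) ts ∎
    where
      open ≤-Reasoning
      regroup : ∀ a b l → 2 * (a + b) + suc l ≡ (2 * a + 1) + (2 * b + l)
      regroup = solve-∀

nodesUpTo-*2^-≤ : ∀ {d t} → LeavesAt d t → Branching t → ∀ j k → k + j ≤ d →
                  nodesUpTo k t * 2 ^ j ≤ nodesUpTo (k + j) t
nodesUpTo-*2^-≤ {t = t} _ _ zero k _ rewrite *-identityʳ (nodesUpTo k t) | +-identityʳ k = ≤-refl
nodesUpTo-*2^-≤ {t = t} ls bs (suc j) k k+j≤d rewrite +-suc k j =
  begin
    N k * (2 * 2 ^ j)  ≡⟨ swap-2 ⟩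
    2 * N k * 2 ^ j    ≤⟨ *-monoˡ-≤ (2 ^ j) (m+n≤o⇒m≤o (2 * N k) (nodesUpTo-doubling ls bs k k<d)) ⟩
    N (suc k) * 2 ^ j  ≤⟨ nodesUpTo-*2^-≤ ls bs j (suc k) k+j≤d ⟩
    N (suc k + j)      ∎
  where
    open ≤-Reasoning
    N : ℕ → ℕ
    N k = nodesUpTo k t
    k<d : k < _
    k<d = ≤-trans (s≤s (m≤m+n k j)) k+j≤d
    swap-2 : N k * (2 * 2 ^ j) ≡ 2 * N k * 2 ^ j
    swap-2 = trans (sym (*-assoc (N k) 2 (2 ^ j))) (cong (_* 2 ^ j) (*-comm (N k) 2))

lemma2 : (B : Tree) → IsBoruvkaTree B → (k : ℕ) → 1 ≤ k →
    nodesUpTo k B * 2 ^ (height B ∸ k) ≤ size B * 2 ^ (k ∸ height B)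
lemma2 B ((_ , ls) , bs) k _ with ≤-total k (height B)
... | inj₁ k≤h rewrite m≤n⇒m∸n≡0 k≤h | *-identityʳ (size B) =
  begin
    nodesUpTo k B * 2 ^ (h ∸ k)  ≤⟨ nodesUpTo-*2^-≤ ls′ bs (h ∸ k) k (≤-reflexive k+[h∸k]≡h) ⟩
    nodesUpTo (k + (h ∸ k)) B    ≡⟨ cong (λ l → nodesUpTo l B) k+[h∸k]≡h ⟩
    nodesUpTo h B                ≡⟨ nodesUpTo-size h B ≤-refl ⟩
    size B                       ∎
  where
    open ≤-Reasoning
    h : ℕ
    h = height B
    ls′ : LeavesAt h B
    ls′ = subst (λ d → LeavesAt d B) (sym (LeavesAt⇒height≡ ls)) ls
    k+[h∸k]≡h : k + (h ∸ k) ≡ h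
    k+[h∸k]≡h = m+[n∸m]≡n k≤h
... | inj₂ h≤k rewrite m≤n⇒m∸n≡0 h≤k | *-identityʳ (nodesUpTo k B) | nodesUpTo-size k B h≤k =
  m≤m*n (size B) (2 ^ (k ∸ height B)) {{m^n≢0 2 (k ∸ height B)}}
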